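{- Let $F$ be a CNF formula, $x$ a variable, and $c \in F$ a clause containing neither $x$ nor $\neg x$ that is superredundant in $F$. If $c \vee \neg x \notin F$, then $c$ is a clause of $F[\mathsf{true}/x]$ and is superredundant in $F[\mathsf{true}/x]$. Likewise, if $c \vee x \notin F$, then $c$ is a clause of $F[\mathsf{false}/x]$ and is superredundant in $F[\mathsf{false}/x]$.
   Context: A CNF formula is a finite set of clauses; a clause is a finite set of literals, read as their disjunction. Tautological clauses are not allowed. Resolution: from clauses $c_1 \vee l$ and $c_2 \vee \neg l$ derive $c_1 \vee c_2$; two clauses whose resolvent would be a tautology are considered not to resolve. The resolution closure $\mathrm{ResCn}(F)$ is the set of all clauses obtainable from $F$ by zero or more resolution steps. A clause $c \in F$ is superredundant in $F$ if $\mathrm{ResCn}(F) \setminus \{c\} \models c$. Substitution: $F[\mathsf{true}/x] = \{d \setminus \{\neg x\} \mid d \in F,\ x \notin d\}$ (clauses containing $x$ are removed, and $\neg x$ is deleted from the others); $F[\mathsf{false}/x]$ is defined symmetrically, $F[\mathsf{false}/x] = \{d \setminus \{x\} \mid d \in F,\ \neg x \notin d\}$. -}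

module Defs where

open import Data.Nat using (ℕ)
open import Data.Fin using (Fin)
open import Data.Bool using (Bool; true; false)
open import Data.Vec using (Vec; lookup; _[_]≔_)
open import Data.Product using (Σ; ∃; _×_)
open import Data.Sum using (_⊎_)
open import Relation.Binary.PropositionalEquality using (_≡_; _≢_)

-- A clause assigns to each variable
-- whether it is absent, occurs positively, or occurs negatively; hence a
-- clause is exactly a finite, non-tautological set of literals.
data Occ : Set where
  none pos neg : Occ

Clause : ℕ → Set
Clause n = Vec Occ n

litOcc : Bool → Occ
litOcc true  = pos
litOcc false = neg

-- A CNF formula is a set of clauses (a predicate on the finite type Clause n,
-- hence automatically a finite set).
Formula : ℕ → Set₁
Formula n = Clause n → Set

data Merge : Occ → Occ → Occ → Set where
  m-l  : ∀ o → Merge o none o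
  m-r  : ∀ o → Merge none o o
  m-eq : ∀ o → Merge o o o

-- r is the resolvent of c₁ ∨ v and c₂ ∨ ¬v (on variable v); the resolvent
-- is required not to be tautological (Merge forbids pos/neg clashes).
Resolvent : ∀ {n} → Clause n → Clause n → Fin n → Clause n → Set
Resolvent c₁ c₂ v r =
  lookup c₁ v ≡ pos × lookup c₂ v ≡ neg × lookup r v ≡ none ×
  (∀ u → u ≢ v → Merge (lookup c₁ u) (lookup c₂ u) (lookup r u))

data ResCn {n} (F : Formula n) : Formula n where
  base : ∀ {c} → F c → ResCn F c
  res  : ∀ {c₁ c₂ r} v → ResCn F c₁ → ResCn F c₂ → Resolvent c₁ c₂ v r → ResCn F r

Assignment : ℕ → Set
Assignment n = Fin n → Bool

Sat : ∀ {n} → Assignment n → Clause n → Set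
Sat α c = ∃ λ i → (lookup c i ≡ pos × α i ≡ true) ⊎ (lookup c i ≡ neg × α i ≡ false)

_⊨_ : ∀ {n} → Formula n → Clause n → Set
G ⊨ c = ∀ α → (∀ d → G d → Sat α d) → Sat α c

-- ResCn(F) \ {c} ⊨ c   (membership c ∈ F is stated separately)
SuperRedundant : ∀ {n} → Formula n → Clause n → Set
SuperRedundant F c = (λ d → ResCn F d × d ≢ c) ⊨ c

Subst : ∀ {n} → Formula n → Fin n → Bool → Formula n
Subst F x b d′ = ∃ λ d → F d × lookup d x ≢ litOcc b × d′ ≡ d [ x ]≔ none

{-# OPTIONS --safe #-}
-- Let ℓ be the literal of x made true by b, F′ = F[b/x], and let α satisfy
-- ResCn(F′) ∖ {c}.  Put α′ = α[x ↦ b].  A clause d ∈ ResCn(F) containing ℓ is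
-- satisfied by α′.  Any other d is subsumed by a clause a ∈ ResCn(F′) not
-- mentioning x: on the leaves a is d with ¬ℓ deleted, a resolution step on x
-- keeps the subsumer of its ¬ℓ-premise, and a step on another variable is
-- replayed in F′.  Because c ∨ ¬ℓ ∉ F, the subsumer a can be c only when d = c
-- or when α already satisfies c.  So α′ satisfies ResCn(F) ∖ {c}, hence c by
-- superredundancy, and then so does α, since c does not mention x.
module Submission where

open import Defs
open import Data.Nat using (ℕ)
open import Data.Fin using (Fin; _≟_)
open import Data.Bool using (Bool; true; false; not)
open import Data.Vec using (lookup; _[_]≔_; zipWith)
open import Data.Vec.Properties
  using (≡-dec; lookup∘update; lookup∘update′; []≔-idempotent; []≔-lookup; lookup-zipWith)
open import Data.Vec.Functional using (updateAt)
open import Data.Vec.Functional.Properties using (updateAt-updates; updateAt-minimal)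
open import Data.Product using (_×_; _,_)
open import Data.Sum using (_⊎_; inj₁; inj₂)
open import Data.Empty using (⊥; ⊥-elim)
open import Function using (const)
open import Relation.Nullary using (¬_; Dec; yes; no)
open import Relation.Binary.PropositionalEquality
  using (_≡_; _≢_; refl; sym; trans; cong; subst; subst₂; cong₂; ≢-sym; module ≡-Reasoning)

_≟O_ : (a b : Occ) → Dec (a ≡ b)
none ≟O none = yes refl
none ≟O pos  = no λ ()
none ≟O neg  = no λ ()
pos  ≟O none = no λ ()
pos  ≟O pos  = yes refl
pos  ≟O neg  = no λ ()
neg  ≟O none = no λ ()
neg  ≟O pos  = no λ ()
neg  ≟O neg  = yes refl

none≢litOcc : ∀ b → none ≢ litOcc b
none≢litOcc true  ()
none≢litOcc false ()

pos≢litOcc⊎neg≢litOcc : ∀ b → pos ≢ litOcc b ⊎ neg ≢ litOcc b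
pos≢litOcc⊎neg≢litOcc true  = inj₂ λ ()
pos≢litOcc⊎neg≢litOcc false = inj₁ λ ()

≢litOcc⇒none⊎litOcc-not : ∀ b o → o ≢ litOcc b → o ≡ none ⊎ o ≡ litOcc (not b)
≢litOcc⇒none⊎litOcc-not b     none o≢ = inj₁ refl
≢litOcc⇒none⊎litOcc-not true  pos  o≢ = ⊥-elim (o≢ refl)
≢litOcc⇒none⊎litOcc-not true  neg  o≢ = inj₂ refl
≢litOcc⇒none⊎litOcc-not false pos  o≢ = inj₂ refl
≢litOcc⇒none⊎litOcc-not false neg  o≢ = ⊥-elim (o≢ refl)

infix 4 _⊑_
_⊑_ : Occ → Occ → Set
a ⊑ o = a ≡ none ⊎ a ≡ o

⊑-trans : ∀ {a b c} → a ⊑ b → b ⊑ c → a ⊑ c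
⊑-trans (inj₁ a≡none) _ = inj₁ a≡none
⊑-trans (inj₂ refl)   q = q

⊑-≢litOcc : ∀ {a o} b → a ⊑ o → o ≢ litOcc b → a ≢ litOcc b
⊑-≢litOcc b (inj₁ refl) _   = none≢litOcc b
⊑-≢litOcc b (inj₂ refl) o≢ = o≢

Merge⇒⊑ˡ : ∀ {a b o} → Merge a b o → a ⊑ o
Merge⇒⊑ˡ (m-l o)  = inj₂ refl
Merge⇒⊑ˡ (m-r o)  = inj₁ refl
Merge⇒⊑ˡ (m-eq o) = inj₂ refl

Merge⇒⊑ʳ : ∀ {a b o} → Merge a b o → b ⊑ o
Merge⇒⊑ʳ (m-l o)  = inj₁ refl
Merge⇒⊑ʳ (m-r o)  = inj₂ refl
Merge⇒⊑ʳ (m-eq o) = inj₂ refl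

infixl 6 _⊔_
_⊔_ : Occ → Occ → Occ
none ⊔ o = o
pos  ⊔ _ = pos
neg  ⊔ _ = neg

⊔-lub : ∀ {a b o} → a ⊑ o → b ⊑ o → a ⊔ b ⊑ o
⊔-lub {o = o}    (inj₁ refl) b⊑o = b⊑o
⊔-lub {o = none} (inj₂ refl) b⊑o = b⊑o
⊔-lub {o = pos}  (inj₂ refl) _   = inj₂ refl
⊔-lub {o = neg}  (inj₂ refl) _   = inj₂ refl

⊑-Merge⇒Merge-⊔ : ∀ {a₁ a₂ c₁ c₂ r} → a₁ ⊑ c₁ → a₂ ⊑ c₂ → Merge c₁ c₂ r →
                  Merge a₁ a₂ (a₁ ⊔ a₂)
⊑-Merge⇒Merge-⊔ {none}           _ _ _ = m-r _
⊑-Merge⇒Merge-⊔ {pos} {none}     _ _ _ = m-l pos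
⊑-Merge⇒Merge-⊔ {pos} {pos}      _ _ _ = m-eq pos
⊑-Merge⇒Merge-⊔ {pos} {neg} (inj₂ refl) (inj₂ refl) ()
⊑-Merge⇒Merge-⊔ {neg} {none}     _ _ _ = m-l neg
⊑-Merge⇒Merge-⊔ {neg} {pos} (inj₂ refl) (inj₂ refl) ()
⊑-Merge⇒Merge-⊔ {neg} {neg}      _ _ _ = m-eq neg

≡pos⇒≢none : ∀ {o} → o ≡ pos → o ≢ none
≡pos⇒≢none refl ()

≡neg⇒≢none : ∀ {o} → o ≡ neg → o ≢ none
≡neg⇒≢none refl ()

-- Sat α c unfolds to ∃ λ i → LitTrue (α i) (lookup c i).
LitTrue : Bool → Occ → Set
LitTrue β o = (o ≡ pos × β ≡ true) ⊎ (o ≡ neg × β ≡ false)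

LitTrue-litOcc : ∀ b → LitTrue b (litOcc b)
LitTrue-litOcc true  = inj₁ (refl , refl)
LitTrue-litOcc false = inj₂ (refl , refl)

LitTrue⇒≢none : ∀ {β o} → LitTrue β o → o ≢ none
LitTrue⇒≢none (inj₁ (refl , _)) ()
LitTrue⇒≢none (inj₂ (refl , _)) ()

LitTrue-⊑ : ∀ {β a o} → a ⊑ o → LitTrue β a → LitTrue β o
LitTrue-⊑ (inj₁ refl) s = ⊥-elim (LitTrue⇒≢none s refl)
LitTrue-⊑ (inj₂ refl) s = s

LitTrue-clash : ∀ {β} → LitTrue β pos → LitTrue β neg → ⊥
LitTrue-clash (inj₁ (_ , refl)) (inj₂ (_ , ()))

module _ {n : ℕ} where

  infix 4 _⊆_ _⊆_except_

  record _⊆_ (a d : Clause n) : Set where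
    constructor mk⊆
    field ⊑-at : ∀ u → lookup a u ⊑ lookup d u

  record _⊆_except_ (a d : Clause n) (v : Fin n) : Set where
    constructor mk⊆-except
    field ⊑-off : ∀ u → u ≢ v → lookup a u ⊑ lookup d u

  open _⊆_ public
  open _⊆_except_ public

  ⊆-trans-except : ∀ {a b d v} → a ⊆ b → b ⊆ d except v → a ⊆ d except v
  ⊆-trans-except a⊆b b⊆d = mk⊆-except λ u u≢v → ⊑-trans (⊑-at a⊆b u) (⊑-off b⊆d u u≢v)

  ⊆-except-none : ∀ {a d v} → a ⊆ d except v → lookup a v ≡ none → a ⊆ d
  ⊆-except-none {a} {d} {v} a⊆d av = mk⊆ ⊑-everywhere
    where
    ⊑-everywhere : ∀ u → lookup a u ⊑ lookup d u
    ⊑-everywhere u with u ≟ v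
    ... | yes refl = inj₁ av
    ... | no u≢v   = ⊑-off a⊆d u u≢v

  ≢-at : ∀ {a d : Clause n} u → lookup a u ≢ lookup d u → a ≢ d
  ≢-at u ne refl = ne refl

  []≔-restore : ∀ {d c : Clause n} x {o} → d [ x ]≔ o ≡ c → d ≡ c [ x ]≔ lookup d x
  []≔-restore {d} {c} x {o} eq = begin
    d                              ≡⟨ sym ([]≔-lookup d x) ⟩
    d [ x ]≔ lookup d x            ≡⟨ sym ([]≔-idempotent d x) ⟩
    d [ x ]≔ o [ x ]≔ lookup d x   ≡⟨ cong (_[ x ]≔ lookup d x) eq ⟩
    c [ x ]≔ lookup d x            ∎
    where open ≡-Reasoning

  Sat-⊆ : ∀ {α a d} → a ⊆ d → Sat α a → Sat α d
  Sat-⊆ a⊆d (i , s) = i , LitTrue-⊑ (⊑-at a⊆d i) s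

  resolvent-⊇ˡ : ∀ {c₁ c₂ v r} → Resolvent c₁ c₂ v r → c₁ ⊆ r except v
  resolvent-⊇ˡ (_ , _ , _ , m) = mk⊆-except λ u u≢v → Merge⇒⊑ˡ (m u u≢v)

  resolvent-⊇ʳ : ∀ {c₁ c₂ v r} → Resolvent c₁ c₂ v r → c₂ ⊆ r except v
  resolvent-⊇ʳ (_ , _ , _ , m) = mk⊆-except λ u u≢v → Merge⇒⊑ʳ (m u u≢v)

  resolvent-sound : ∀ {α c₁ c₂ v r} → Resolvent c₁ c₂ v r → Sat α c₁ → Sat α c₂ → Sat α r
  resolvent-sound {c₁ = c₁} {c₂} {v} {r} rv@(p₁ , p₂ , _ , _) (i , s₁) (j , s₂)
    with i ≟ v | j ≟ v
  ... | no i≢v   | _        =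
    i , LitTrue-⊑ (⊑-off (resolvent-⊇ˡ {c₁ = c₁} {c₂} {v} {r} rv) i i≢v) s₁
  ... | yes _    | no j≢v   =
    j , LitTrue-⊑ (⊑-off (resolvent-⊇ʳ {c₁ = c₁} {c₂} {v} {r} rv) j j≢v) s₂
  ... | yes refl | yes refl =
    ⊥-elim (LitTrue-clash (subst (LitTrue _) p₁ s₁) (subst (LitTrue _) p₂ s₂))

  resolve : Clause n → Clause n → Fin n → Clause n
  resolve a₁ a₂ v = zipWith _⊔_ a₁ a₂ [ v ]≔ none

  lookup-resolve : ∀ a₁ a₂ {u v} → u ≢ v →
                   lookup (resolve a₁ a₂ v) u ≡ lookup a₁ u ⊔ lookup a₂ u
  lookup-resolve a₁ a₂ {u} u≢v =
    trans (lookup∘update′ u≢v (zipWith _⊔_ a₁ a₂) none) (lookup-zipWith _⊔_ u a₁ a₂)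

  lookup-resolve-pivot : ∀ a₁ a₂ v → lookup (resolve a₁ a₂ v) v ≡ none
  lookup-resolve-pivot a₁ a₂ v = lookup∘update v (zipWith _⊔_ a₁ a₂) none

  resolve-Resolvent : ∀ {a₁ a₂ c₁ c₂ v r} → Resolvent c₁ c₂ v r → a₁ ⊆ c₁ → a₂ ⊆ c₂ →
                      lookup a₁ v ≡ pos → lookup a₂ v ≡ neg →
                      Resolvent a₁ a₂ v (resolve a₁ a₂ v)
  resolve-Resolvent {a₁} {a₂} {v = v} (_ , _ , _ , m) a₁⊆c₁ a₂⊆c₂ p₁ p₂ =
    p₁ , p₂ , lookup-resolve-pivot a₁ a₂ v , λ u u≢v →
      subst (Merge _ _) (sym (lookup-resolve a₁ a₂ u≢v))
        (⊑-Merge⇒Merge-⊔ (⊑-at a₁⊆c₁ u) (⊑-at a₂⊆c₂ u) (m u u≢v))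

  resolve-⊆ : ∀ {a₁ a₂ c₁ c₂ v r} → a₁ ⊆ c₁ → a₂ ⊆ c₂ →
              c₁ ⊆ r except v → c₂ ⊆ r except v → resolve a₁ a₂ v ⊆ r
  resolve-⊆ {a₁} {a₂} {v = v} a₁⊆c₁ a₂⊆c₂ c₁⊆r c₂⊆r =
    ⊆-except-none (mk⊆-except λ u u≢v → subst (_⊑ _) (sym (lookup-resolve a₁ a₂ u≢v))
                     (⊔-lub (⊑-off (⊆-trans-except a₁⊆c₁ c₁⊆r) u u≢v)
                            (⊑-off (⊆-trans-except a₂⊆c₂ c₂⊆r) u u≢v)))
                  (lookup-resolve-pivot a₁ a₂ v)

module _ {n : ℕ} where

  Sat-agree : ∀ {α β : Assignment n} a →
              (∀ i → lookup a i ≢ none → α i ≡ β i) → Sat α a → Sat β a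
  Sat-agree _ agree (i , s) = i , subst (λ t → LitTrue t _) (agree i (LitTrue⇒≢none s)) s

  Sat-updateAt⁺ : ∀ {α} x {f} a → lookup a x ≡ none → Sat α a → Sat (updateAt α x f) a
  Sat-updateAt⁺ {α} x a ax =
    Sat-agree a λ i ai → sym (updateAt-minimal i x α λ { refl → ai ax })

  Sat-updateAt⁻ : ∀ {α} x {f} a → lookup a x ≡ none → Sat (updateAt α x f) a → Sat α a
  Sat-updateAt⁻ {α} x a ax =
    Sat-agree a λ i ai → updateAt-minimal i x α λ { refl → ai ax }

  Sat-updateAt-litOcc : ∀ α x b (d : Clause n) → lookup d x ≡ litOcc b →
                        Sat (updateAt α x (const b)) d
  Sat-updateAt-litOcc α x b d dx =
    x , subst₂ LitTrue (sym (updateAt-updates x α)) (sym dx) (LitTrue-litOcc b)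

Subst-∋ : ∀ {n} {F : Formula n} {x c} b → F c → lookup c x ≡ none → Subst F x b c
Subst-∋ {x = x} {c} b Fc cx =
  c , Fc , subst (_≢ _) (sym cx) (none≢litOcc b) ,
  sym (trans (cong (c [ x ]≔_) (sym cx)) ([]≔-lookup c x))

module Lifting {n} (F : Formula n) (x : Fin n) (b : Bool) (c : Clause n)
  (cx : lookup c x ≡ none) (c∨¬ℓ∉F : ¬ F (c [ x ]≔ litOcc (not b)))
  (α : Assignment n) (α⊨ : ∀ e → ResCn (Subst F x b) e × e ≢ c → Sat α e) where

  -- at-c may fall back on Sat α c: the replay of a resolution step on v ≠ x
  -- can produce exactly c, and then α satisfies c by soundness.
  record Lift (d : Clause n) : Set where
    field
      clause   : Clause n
      derived  : ResCn (Subst F x b) clause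
      x-free   : lookup clause x ≡ none
      subsumes : clause ⊆ d
      at-c     : clause ≡ c → d ≡ c ⊎ Sat α c

  open Lift public

  lift-base : ∀ {d} → F d → lookup d x ≢ litOcc b → Lift d
  lift-base {d} Fd dx = record
    { clause   = d [ x ]≔ none
    ; derived  = base (d , Fd , dx , refl)
    ; x-free   = lookup∘update x d none
    ; subsumes = ⊆-except-none (mk⊆-except λ u u≢x → inj₂ (lookup∘update′ u≢x d none))
                               (lookup∘update x d none)
    ; at-c     = λ eq → inj₁ (restored eq (≢litOcc⇒none⊎litOcc-not b (lookup d x) dx))
    }
    where
    restored : d [ x ]≔ none ≡ c → lookup d x ≡ none ⊎ lookup d x ≡ litOcc (not b) → d ≡ c
    restored eq (inj₁ dx≡none) =
      trans ([]≔-restore x eq)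
            (trans (cong (c [ x ]≔_) (trans dx≡none (sym cx))) ([]≔-lookup c x))
    restored eq (inj₂ dx≡¬ℓ) =
      ⊥-elim (c∨¬ℓ∉F (subst F (trans ([]≔-restore x eq) (cong (c [ x ]≔_) dx≡¬ℓ)) Fd))

  lift-⊆ : ∀ {d r} (L : Lift d) → d ≢ clause L → clause L ⊆ r → Lift r
  lift-⊆ {d} L d≢a a⊆r = record
    { clause = clause L ; derived = derived L ; x-free = x-free L ; subsumes = a⊆r
    ; at-c   = λ eq → inj₂ (sat (at-c L eq) eq) }
    where
    sat : d ≡ c ⊎ Sat α c → clause L ≡ c → Sat α c
    sat (inj₁ d≡c) eq = ⊥-elim (d≢a (trans d≡c (sym eq)))
    sat (inj₂ s)   _  = s

  lift-except : ∀ {d r v} (L : Lift d) → lookup d v ≢ none → lookup (clause L) v ≡ none →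
                d ⊆ r except v → Lift r
  lift-except {v = v} L dv av d⊆r =
    lift-⊆ L (≢-at v λ e → dv (trans e av)) (⊆-except-none (⊆-trans-except (subsumes L) d⊆r) av)

  lift-resolve : ∀ {c₁ c₂ v r} → Resolvent c₁ c₂ v r → c₁ ⊆ r except v → c₂ ⊆ r except v →
                 v ≢ x → Lift c₁ → Lift c₂ → Lift r
  lift-resolve {c₁} {c₂} {v} {r} rv@(p₁ , p₂ , _ , _) c₁⊆r c₂⊆r v≢x L₁ L₂
    with ⊑-at (subsumes L₁) v | ⊑-at (subsumes L₂) v
  ... | inj₁ a₁v | _        = lift-except L₁ (≡pos⇒≢none p₁) a₁v c₁⊆r
  ... | inj₂ _   | inj₁ a₂v = lift-except L₂ (≡neg⇒≢none p₂) a₂v c₂⊆r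
  ... | inj₂ a₁v | inj₂ a₂v = record
    { clause   = e
    ; derived  = res v (derived L₁) (derived L₂) e-res
    ; x-free   = trans (lookup-resolve (clause L₁) (clause L₂) (≢-sym v≢x))
                       (cong₂ _⊔_ (x-free L₁) (x-free L₂))
    ; subsumes = resolve-⊆ (subsumes L₁) (subsumes L₂) c₁⊆r c₂⊆r
    ; at-c     = λ e≡c → inj₂ (subst (Sat α) e≡c (e-sat e≡c))
    }
    where
    a₁≡pos : lookup (clause L₁) v ≡ pos
    a₁≡pos = trans a₁v p₁
    a₂≡neg : lookup (clause L₂) v ≡ neg
    a₂≡neg = trans a₂v p₂
    e : Clause n
    e = resolve (clause L₁) (clause L₂) v
    e-res : Resolvent (clause L₁) (clause L₂) v e
    e-res = resolve-Resolvent {c₁ = c₁} {c₂} {v} {r} rv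
              (subsumes L₁) (subsumes L₂) a₁≡pos a₂≡neg
    sat : ∀ {d} (L : Lift d) → lookup (clause L) v ≢ none → e ≡ c → Sat α (clause L)
    sat L av e≡c = α⊨ (clause L) (derived L , ≢-at v λ eq → av (begin
      lookup (clause L) v ≡⟨ eq ⟩
      lookup c v          ≡⟨ cong (λ z → lookup z v) (sym e≡c) ⟩
      lookup e v          ≡⟨ lookup-resolve-pivot (clause L₁) (clause L₂) v ⟩
      none                ∎))
      where open ≡-Reasoning
    e-sat : e ≡ c → Sat α e
    e-sat e≡c = resolvent-sound {c₁ = clause L₁} {clause L₂} {v} {e} e-res
      (sat L₁ (≡pos⇒≢none a₁≡pos) e≡c) (sat L₂ (≡neg⇒≢none a₂≡neg) e≡c)

  lift : ∀ {d} → ResCn F d → lookup d x ≢ litOcc b → Lift d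
  lift (base Fd) dx = lift-base Fd dx
  lift {r} (res {c₁} {c₂} v R₁ R₂ rv@(p₁ , p₂ , _ , _)) rx
    with resolvent-⊇ˡ {c₁ = c₁} {c₂} {v} {r} rv
       | resolvent-⊇ʳ {c₁ = c₁} {c₂} {v} {r} rv
       | v ≟ x
  ... | c₁⊆r | c₂⊆r | no v≢x =
    lift-resolve rv c₁⊆r c₂⊆r v≢x (lift R₁ (⊑-≢litOcc b (⊑-off c₁⊆r x (≢-sym v≢x)) rx))
                                  (lift R₂ (⊑-≢litOcc b (⊑-off c₂⊆r x (≢-sym v≢x)) rx))
  ... | c₁⊆r | c₂⊆r | yes refl with pos≢litOcc⊎neg≢litOcc b
  ...   | inj₁ pos≢ℓ = lift-except L₁ (≡pos⇒≢none p₁) (x-free L₁) c₁⊆r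
    where
    L₁ : Lift c₁
    L₁ = lift R₁ (subst (_≢ _) (sym p₁) pos≢ℓ)
  ...   | inj₂ neg≢ℓ = lift-except L₂ (≡neg⇒≢none p₂) (x-free L₂) c₂⊆r
    where
    L₂ : Lift c₂
    L₂ = lift R₂ (subst (_≢ _) (sym p₂) neg≢ℓ)

  Lift⇒Sat : ∀ {d} (L : Lift d) → d ≢ c → Sat α (clause L)
  Lift⇒Sat L d≢c with ≡-dec _≟O_ (clause L) c
  ... | no a≢c = α⊨ (clause L) (derived L , a≢c)
  ... | yes refl with at-c L refl
  ...   | inj₁ d≡c = ⊥-elim (d≢c d≡c)
  ...   | inj₂ s   = s

Subst-superRedundant : ∀ {n} {F : Formula n} {x c} b → lookup c x ≡ none →
                       SuperRedundant F c → ¬ F (c [ x ]≔ litOcc (not b)) →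
                       SuperRedundant (Subst F x b) c
Subst-superRedundant {F = F} {x} {c} b cx sr c∨¬ℓ∉F α α⊨ =
  Sat-updateAt⁻ x c cx (sr (updateAt α x (const b)) α′⊨)
  where
  open Lifting F x b c cx c∨¬ℓ∉F α α⊨
  α′⊨ : ∀ d → ResCn F d × d ≢ c → Sat (updateAt α x (const b)) d
  α′⊨ d (R , d≢c) with lookup d x ≟O litOcc b
  ... | yes dx = Sat-updateAt-litOcc α x b d dx
  ... | no dx  = Sat-⊆ (subsumes L) (Sat-updateAt⁺ x (clause L) (x-free L) (Lift⇒Sat L d≢c))
    where
    L : Lift d
    L = lift R dx

lemma12 : ∀ {n} (F : Formula n) (x : Fin n) (c : Clause n) →
    F c → lookup c x ≡ none → SuperRedundant F c →
    ((¬ F (c [ x ]≔ neg) → Subst F x true c × SuperRedundant (Subst F x true) c) ×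
     (¬ F (c [ x ]≔ pos) → Subst F x false c × SuperRedundant (Subst F x false) c))
lemma12 F x c Fc cx sr =
  (λ c∨¬x∉F → Subst-∋ true  Fc cx , Subst-superRedundant true  cx sr c∨¬x∉F) ,
  (λ c∨x∉F  → Subst-∋ false Fc cx , Subst-superRedundant false cx sr c∨x∉F)
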